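{- Let $m \geq 1$ be an integer and let $G \in ER(n,d,\lambda)$ have a uniform shared neighborhood structure isomorphic to $H$. Then $D_m(G) \in ER(mn,md,m\lambda)$ and $D_m(G)$ has a uniform shared neighborhood structure isomorphic to $D_m(H)$.
   Context: For a graph $G$ with $V(G)=\{v_1,\dots,v_n\}$ and a positive integer $m$, the $m$-th shadow graph $D_m(G)$ has vertex set $\{v^i_j : i\in[m], j\in[n]\}$, with $v^i_j \sim v^k_l$ iff $v_j\sim v_l$ in $G$ (for any $i,k\in[m]$). For a finite simple graph $G$, $N(u)$ is the open neighborhood of $u$. $G \in ER(n,d,\lambda)$ means $G$ has $n$ vertices, is $d$-regular, and every pair of adjacent vertices has exactly $\lambda$ common neighbors. $G$ has a uniform shared neighborhood structure isomorphic to $H$ if the induced subgraph $G[N(u)\cap N(v)]$ is isomorphic to $H$ for all adjacent $u,v$. -}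

module Defs where

open import Data.Nat using (ℕ; zero; suc; _+_; _*_)
open import Data.Bool using (Bool; true; false; T; _∧_)
open import Data.Fin using (Fin; zero; suc; remQuot)
open import Data.Product using (Σ; _×_; _,_; proj₁; proj₂)
open import Function.Bundles using (Bijection)
open import Relation.Binary.PropositionalEquality using (_≡_)

record Graph (n : ℕ) : Set where
  field
    adj    : Fin n → Fin n → Bool
    sym    : ∀ u v → adj u v ≡ adj v u
    irrefl : ∀ u → adj u u ≡ false

open Graph public

count : ∀ {n} → (Fin n → Bool) → ℕ
count {zero}  P = 0
count {suc n} P with P zero
... | true  = suc (count (λ i → P (suc i)))
... | false = count (λ i → P (suc i))

Adjacent : ∀ {n} → Graph n → Fin n → Fin n → Set
Adjacent G u v = T (adj G u v)

degree : ∀ {n} → Graph n → Fin n → ℕ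
degree G u = count (adj G u)

commonNbr : ∀ {n} → Graph n → Fin n → Fin n → Fin n → Bool
commonNbr G u v w = adj G u w ∧ adj G v w

ER : (n d λ' : ℕ) → Graph n → Set
ER n d λ' G =
  (∀ u → degree G u ≡ d) ×
  (∀ u v → Adjacent G u v → count (commonNbr G u v) ≡ λ')

InducedIso : ∀ {n k} → Graph n → (Fin n → Bool) → Graph k → Set
InducedIso {n} {k} G S H =
  Σ (Bijection (≡-setoid′ (Fin k)) (≡-setoid′ (Σ (Fin n) (λ w → T (S w)))))
    (λ f → ∀ i j → adj H i j ≡ adj G (proj₁ (Bijection.to f i)) (proj₁ (Bijection.to f j)))
  where open import Relation.Binary.PropositionalEquality using () renaming (setoid to ≡-setoid′)

UniformSNS : ∀ {n k} → Graph n → Graph k → Set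
UniformSNS G H = ∀ u v → Adjacent G u v → InducedIso G (commonNbr G u v) H

-- m-th shadow graph D_m(G): vertex v^i_j is  combine i j : Fin (m * n),
-- i.e. remQuot {m} n x = (i , j); v^i_j ∼ v^k_l iff v_j ∼ v_l in G
shadow : ∀ {n} (m : ℕ) → Graph n → Graph (m * n)
shadow {n} m G = record
  { adj    = λ x y → adj G (proj₂ (remQuot {m} n x)) (proj₂ (remQuot {m} n y))
  ; sym    = λ x y → sym G (proj₂ (remQuot {m} n x)) (proj₂ (remQuot {m} n y))
  ; irrefl = λ x → irrefl G (proj₂ (remQuot {m} n x))
  }

{-# OPTIONS --safe #-}
module Submission where

-- A vertex v^i_j of D_m(G) is remembered by its layer i and its base vertex
-- v_j, and adjacency only looks at the base.  Hence every neighbourhood and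
-- every common neighbourhood in D_m(G) is the full m-layer preimage of the
-- corresponding set in G, so all counts are multiplied by m; and a bijection
-- from H onto G[N(u) ∩ N(v)], applied in each layer separately, is a bijection
-- from D_m(H) onto the induced subgraph on that preimage that still
-- preserves adjacency.

open import Defs
open import Data.Nat using (ℕ; _≤_; _*_; _+_; zero; suc)
open import Data.Bool using (Bool; true; false; T)
open import Data.Fin using (Fin; zero; suc; remainder; quotient; combine; _↑ˡ_; _↑ʳ_)
open import Data.Fin.Properties using (*↔×; remQuot-combine; splitAt-↑ʳ)
open import Data.Product using (Σ; _×_; _,_; proj₁; proj₂)
open import Data.Product.Algebra using (Σ-assoc)
open import Data.Product.Function.Dependent.Propositional using (Σ-↔)
open import Data.Product.Function.NonDependent.Propositional using (_×-↔_)
open import Function using (_∘_; _↔_; Inverse)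
open import Function.Properties.Bijection using (⤖⇒↔)
open import Function.Properties.Inverse using (↔-refl; ↔-sym; ↔-trans; ↔⇒⤖)
open import Relation.Binary.PropositionalEquality as ≡ using (_≡_; refl; cong; cong₂; trans; module ≡-Reasoning)

remainder-combine : ∀ {m n} (i : Fin m) (j : Fin n) → remainder {m} n (combine i j) ≡ j
remainder-combine {m} i j = cong proj₂ (remQuot-combine i j)

remainder-↑ʳ : ∀ {m} n (j : Fin (m * n)) → remainder {suc m} n (n ↑ʳ j) ≡ remainder {m} n j
remainder-↑ʳ {m} n j rewrite splitAt-↑ʳ n (m * n) j = refl

count-cong : ∀ {n} {P Q : Fin n → Bool} → (∀ i → P i ≡ Q i) → count P ≡ count Q
count-cong {zero}              P≡Q = refl
count-cong {suc n} {P} {Q} P≡Q with P zero | Q zero | P≡Q zero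
... | true  | true  | refl = cong suc (count-cong (P≡Q ∘ suc))
... | false | false | refl = count-cong (P≡Q ∘ suc)

count-↑ˡ-↑ʳ : ∀ n {k} (P : Fin (n + k) → Bool) →
              count P ≡ count (P ∘ (_↑ˡ k)) + count (P ∘ (n ↑ʳ_))
count-↑ˡ-↑ʳ zero    P = refl
count-↑ˡ-↑ʳ (suc n) P with P zero
... | true  = cong suc (count-↑ˡ-↑ʳ n (P ∘ suc))
... | false = count-↑ˡ-↑ʳ n (P ∘ suc)

count-∘-remainder : ∀ m {n} (P : Fin n → Bool) → count (P ∘ remainder {m} n) ≡ m * count P
count-∘-remainder zero        P = refl
count-∘-remainder (suc m) {n} P = begin
  count (P ∘ remainder {suc m} n)
    ≡⟨ count-↑ˡ-↑ʳ n (P ∘ remainder {suc m} n) ⟩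
  count (P ∘ remainder {suc m} n ∘ (_↑ˡ m * n)) + count (P ∘ remainder {suc m} n ∘ (n ↑ʳ_))
    ≡⟨ cong₂ _+_ (count-cong (cong P ∘ remainder-combine {suc m} zero))
                 (count-cong (cong P ∘ remainder-↑ʳ {m} n)) ⟩
  count P + count (P ∘ remainder {m} n)
    ≡⟨ cong (count P +_) (count-∘-remainder m P) ⟩
  count P + m * count P ∎
  where open ≡-Reasoning

shadow-ER : ∀ m {n d λ'} (G : Graph n) → ER n d λ' G → ER (m * n) (m * d) (m * λ') (shadow m G)
shadow-ER m {n} G (regular , common) =
  (λ u → trans (count-∘-remainder m (adj G (remainder {m} n u))) (cong (m *_) (regular _))) ,
  (λ u v u∼v → trans (count-∘-remainder m (commonNbr G (remainder {m} n u) (remainder {m} n v)))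
                     (cong (m *_) (common _ _ u∼v)))

module _ (m : ℕ) {n} (P : Fin n → Set) where

  remainder-Σ-↔ : Σ (Fin (m * n)) (P ∘ remainder {m} n) ↔ (Fin m × Σ (Fin n) P)
  remainder-Σ-↔ = ↔-trans (Σ-↔ *↔× ↔-refl) Σ-assoc

  shadow-↔ : ∀ {k} → Fin k ↔ Σ (Fin n) P → Fin (m * k) ↔ Σ (Fin (m * n)) (P ∘ remainder {m} n)
  shadow-↔ f = ↔-trans *↔× (↔-trans (↔-refl ×-↔ f) (↔-sym remainder-Σ-↔))

  remainder-shadow-↔ : ∀ {k} (f : Fin k ↔ Σ (Fin n) P) z →
    remainder {m} n (proj₁ (Inverse.to (shadow-↔ f) z)) ≡ proj₁ (Inverse.to f (remainder {m} k z))
  remainder-shadow-↔ {k} f z = remainder-combine (quotient {m} k z) _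

shadow-InducedIso : ∀ m {n k} (G : Graph n) (S : Fin n → Bool) (H : Graph k) →
  InducedIso G S H → InducedIso (shadow m G) (S ∘ remainder {m} n) (shadow m H)
shadow-InducedIso m {n} {k} G S H (f , preserves) = ↔⇒⤖ lifted , preserves′
  where
  f↔ : Fin k ↔ Σ (Fin n) (T ∘ S)
  f↔ = ⤖⇒↔ f

  lifted : Fin (m * k) ↔ Σ (Fin (m * n)) (T ∘ S ∘ remainder {m} n)
  lifted = shadow-↔ m (T ∘ S) f↔

  base : Fin (m * k) → Fin n
  base z = remainder {m} n (proj₁ (Inverse.to lifted z))

  preserves′ : ∀ i j → adj H (remainder {m} k i) (remainder {m} k j) ≡ adj G (base i) (base j)
  preserves′ i j = trans (preserves _ _)
    (≡.sym (cong₂ (adj G) (remainder-shadow-↔ m (T ∘ S) f↔ i) (remainder-shadow-↔ m (T ∘ S) f↔ j)))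

shadow-UniformSNS : ∀ m {n k} (G : Graph n) (H : Graph k) →
  UniformSNS G H → UniformSNS (shadow m G) (shadow m H)
shadow-UniformSNS m {n} G H sns u v u∼v =
  shadow-InducedIso m G (commonNbr G (remainder {m} n u) (remainder {m} n v)) H (sns _ _ u∼v)

theorem9 : (m n d λ' k : ℕ) → 1 ≤ m → (G : Graph n) → (H : Graph k) →
    ER n d λ' G → UniformSNS G H →
    ER (m * n) (m * d) (m * λ') (shadow m G) × UniformSNS (shadow m G) (shadow m H)
theorem9 m n d λ' k _ G H er sns = shadow-ER m G er , shadow-UniformSNS m G H sns
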